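{- Let $k\geq 2$ be an integer. Then there is an integer $M\geq 1$ such that for every $k$-tuple $b_1,\dots,b_k$ of multiplicatively independent integers, each at least $M$, there are infinitely many positive integers $n$ such that for every $i\in\{1,\dots,k\}$ the base-$b_i$ expansion of $n$ does not contain the digit $0$.
   Context: Numbers $a_1,\dots,a_k$ are called multiplicatively independent if none of them is $0$ or $1$ and $1,\log a_2/\log a_1,\dots,\log a_k/\log a_1$ are linearly independent over $\mathbb{Q}$. -}

module Defs where

open import Data.Nat using (ℕ; zero; suc; _*_; _^_; _≤_; NonZero)
open import Data.Nat.Properties using (m^n≢0)
open import Data.Nat.DivMod using (_/_; _%_)
open import Data.Fin using (Fin; zero; suc)
open import Relation.Binary.PropositionalEquality using (_≡_; _≢_)

prodPow : (k : ℕ) → (Fin k → ℕ) → (Fin k → ℕ) → ℕ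
prodPow zero    b e = 1
prodPow (suc k) b e = (b zero ^ e zero) * prodPow k (λ i → b (suc i)) (λ i → e (suc i))

-- Multiplicative independence of positive integers b_1..b_k, written without
-- logarithms: the only relation ∏ b_i^{e_i} = ∏ b_i^{f_i} (e,f ∈ ℕ^k) is e = f,
-- i.e. no nontrivial integer relation ∏ b_i^{c_i} = 1 (c ∈ ℤ^k).
MultIndep : (k : ℕ) → (Fin k → ℕ) → Set
MultIndep k b = (e f : Fin k → ℕ) → prodPow k b e ≡ prodPow k b f → (i : Fin k) → e i ≡ f i

-- j-th base-b digit of n (coefficient of b^j), i.e. ⌊n / b^j⌋ mod b  (junk 0 for b = 0)
digit : ℕ → ℕ → ℕ → ℕ
digit zero    n j = 0
digit (suc b) n j = (n / (suc b ^ j)) {{m^n≢0 (suc b) j}} % suc b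

-- the base-b expansion of n contains no digit 0: every digit at a position j
-- with b^j ≤ n (the positions actually occurring in the expansion) is nonzero
NoZeroDigit : ℕ → ℕ → Set
NoZeroDigit b n = (j : ℕ) → b ^ j ≤ n → digit b n j ≢ 0

-- Nested intervals.  Put K = 3 ^ k and call an interval of length L cleared when, in every
-- base, all digits of weight b ^ j > L / K are nonzero throughout it.  A cleared interval of
-- length K σ contains a cleared interval of length σ: the digits still to be controlled have
-- weight σ / K < b ^ j ≤ σ, and as b > K * K each base has at most one such position j.  The
-- interval is shorter than the period b ^ (j + 1) of that digit by at least b ^ j, so its
-- elements whose j-th digit is 0 form one block of at most b ^ j consecutive integers, and one
-- of two disjoint subintervals of a third of its length avoids that block; treating the k
-- bases in turn costs the factor 3 ^ k = K.  Starting from [K ^ N, 2 K ^ N), where all digits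
-- of large weight are leading digits, N such steps leave a single n > N with no digit 0 in
-- any base.
module Submission where

open import Level using (0ℓ)
open import Data.Nat
open import Data.Nat.Properties
open import Data.Nat.DivMod
open import Data.Fin using (Fin; zero; suc)
open import Data.Product using (_×_; _,_; ∃-syntax)
open import Data.Sum using (inj₁; inj₂; [_,_])
open import Function using (_∘_; id)
open import Relation.Binary.Definitions using (tri<; tri≈; tri>)
open import Relation.Binary.PropositionalEquality
  using (_≡_; _≢_; refl; sym; trans; cong; subst; module ≡-Reasoning)
open import Relation.Nullary using (¬_; Dec; yes; no; contradiction)
open import Relation.Nullary.Decidable using (_×-dec_; map′)
open import Relation.Unary using (Pred; _∈_; _⊆_; _∪_; ∁)

open import Defs

n<m^n : ∀ {m} n → 1 < m → n < m ^ n
n<m^n zero    _   = z<s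
n<m^n {m@(suc _)} (suc n) 1<m = begin-strict
  1 + n         <⟨ +-mono-≤-< (m^n>0 m n) (n<m^n n 1<m) ⟩
  m ^ n + m ^ n ≡⟨ cong (m ^ n +_) (+-identityʳ (m ^ n)) ⟨
  2 * m ^ n     ≤⟨ *-monoˡ-≤ (m ^ n) 1<m ⟩
  m * m ^ n     ∎
  where open ≤-Reasoning

[_,+_⟩ : ℕ → ℕ → Pred ℕ 0ℓ
[ x ,+ m ⟩ n = x ≤ n × n < x + m

interval-⊆ : ∀ {x m y u} → x ≤ y → y + u ≤ x + m → [ y ,+ u ⟩ ⊆ [ x ,+ m ⟩
interval-⊆ x≤y end≤ (y≤n , n<y+u) = ≤-trans x≤y y≤n , <-≤-trans n<y+u end≤

interval-mono : ∀ {x m m′} → m ≤ m′ → [ x ,+ m ⟩ ⊆ [ x ,+ m′ ⟩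
interval-mono {x} m≤m′ = interval-⊆ ≤-refl (+-monoʳ-≤ x m≤m′)

avoid-block : ∀ x u g p → ∃[ y ] ([ y ,+ u ⟩ ⊆ [ x ,+ u + g + u ⟩ × [ y ,+ u ⟩ ⊆ ∁ [ p ,+ g ⟩)
avoid-block x u g p with x + u ≤? p
... | yes x+u≤p =
  x , interval-mono (≤-trans (m≤m+n u g) (m≤m+n (u + g) u)) ,
  λ (_ , n<x+u) (p≤n , _) → <⇒≱ (<-≤-trans n<x+u x+u≤p) p≤n
... | no x+u≰p =
  x + (u + g) , interval-⊆ (m≤m+n x (u + g)) (≤-reflexive (+-assoc x (u + g) u)) ,
  λ (y≤n , _) (_ , n<p+g) → <⇒≱ n<p+g (<⇒≤ (<-≤-trans p+g<y y≤n))
  where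
  p+g<y : p + g < x + (u + g)
  p+g<y = <-≤-trans (+-monoˡ-< g (≰⇒> x+u≰p)) (≤-reflexive (+-assoc x u g))

NoZeroDigitAt : ℕ → ℕ → Pred ℕ 0ℓ
NoZeroDigitAt b j n = b ^ j ≤ n → digit b n j ≢ 0

digit≡ : ∀ b .{{_ : NonZero b}} n j → digit b n j ≡ (n / b ^ j) {{m^n≢0 b j}} % b
digit≡ (suc _) n j = refl

module _ (b : ℕ) .{{_ : NonZero b}} (j : ℕ) where

  private instance
    b^j≢0   = m^n≢0 b j
    b^1+j≢0 = m^n≢0 b (suc j)

  noZeroDigitAt-residue : ∀ n → b ^ j ≤ n % b ^ suc j → NoZeroDigitAt b j n
  noZeroDigitAt-residue n g≤n%d _ digit≡0 = <⇒≢ (m≥n⇒m/n>0 g≤n%d) (sym (begin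
    n % (b * b ^ j) / b ^ j ≡⟨ m%[n*o]/o≡m/o%n n b (b ^ j) ⟩
    n / b ^ j % b           ≡⟨ digit≡ b n j ⟨
    digit b n j             ≡⟨ digit≡0 ⟩
    0                       ∎))
    where open ≡-Reasoning

  noZeroDigitAt-leading : ∀ n → n < b ^ suc j → NoZeroDigitAt b j n
  noZeroDigitAt-leading n n<b^[1+j] g≤n =
    noZeroDigitAt-residue n (subst (b ^ j ≤_) (sym (m<n⇒m%n≡m n<b^[1+j])) g≤n) g≤n

  zeroBlock-or-noZeroDigitAt : ∀ t →
    [ t * b ^ suc j ,+ b ^ suc j ⟩ ⊆ [ t * b ^ suc j ,+ b ^ j ⟩ ∪ NoZeroDigitAt b j
  zeroBlock-or-noZeroDigitAt t {n} (p≤n , n<p+d) with m≤n⇒∃[o]m+o≡n p≤n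
  ... | r , refl with b ^ j ≤? r
  ...   | yes g≤r = inj₂ (noZeroDigitAt-residue n (subst (b ^ j ≤_) (sym n%d≡r) g≤r))
    where
    d = b ^ suc j
    n%d≡r : (t * d + r) % d ≡ r
    n%d≡r = trans (cong (_% d) (+-comm (t * d) r))
                  (trans ([m+kn]%n≡m%n r t d) (m<n⇒m%n≡m (+-cancelˡ-< (t * d) r d n<p+d)))
  ...   | no g≰r = inj₁ (p≤n , +-monoʳ-< (t * b ^ suc j) (≰⇒> g≰r))

  zeroDigitAt-in-one-block : ∀ x m → m + b ^ j ≤ b ^ suc j →
    ∃[ p ] [ x ,+ m ⟩ ⊆ [ p ,+ b ^ j ⟩ ∪ NoZeroDigitAt b j
  zeroDigitAt-in-one-block x m m+g≤d
    with x % b ^ suc j | x / b ^ suc j | m%n<n x (b ^ suc j)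
       | trans (m≡m%n+[m/n]*n x (b ^ suc j)) (+-comm (x % b ^ suc j) (x / b ^ suc j * b ^ suc j))
  ... | r | t | r<d | refl with r <? b ^ j
  ...   | yes r<g = t * d , λ {n} (x≤n , n<x+m) →
    zeroBlock-or-noZeroDigitAt t (≤-trans (m≤m+n (t * d) r) x≤n , (begin-strict
      n               <⟨ n<x+m ⟩
      t * d + r + m   ≡⟨ +-assoc (t * d) r m ⟩
      t * d + (r + m) <⟨ +-monoʳ-< (t * d) (+-monoˡ-< m r<g) ⟩
      t * d + (g + m) ≤⟨ +-monoʳ-≤ (t * d) (≤-trans (≤-reflexive (+-comm g m)) m+g≤d) ⟩
      t * d + d       ∎))
    where
    g = b ^ j
    d = b ^ suc j
    open ≤-Reasoning
  ...   | no r≮g = suc t * d , in-block-or-good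
    where
    d = b ^ suc j
    open ≤-Reasoning
    in-block-or-good : [ t * d + r ,+ m ⟩ ⊆ [ suc t * d ,+ b ^ j ⟩ ∪ NoZeroDigitAt b j
    in-block-or-good {n} (x≤n , n<x+m) with n <? t * d + d
    ... | yes n<t*d+d with zeroBlock-or-noZeroDigitAt t (≤-trans (m≤m+n (t * d) r) x≤n , n<t*d+d)
    ...   | inj₁ (_ , n<t*d+g) =
      contradiction (≤-trans (+-monoʳ-≤ (t * d) (≮⇒≥ r≮g)) x≤n) (<⇒≱ n<t*d+g)
    ...   | inj₂ good = inj₂ good
    in-block-or-good {n} (x≤n , n<x+m) | no n≮t*d+d =
      zeroBlock-or-noZeroDigitAt (suc t)
        (≤-trans (≤-reflexive (+-comm d (t * d))) (≮⇒≥ n≮t*d+d) , (begin-strict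
          n               <⟨ n<x+m ⟩
          t * d + r + m   ≡⟨ +-assoc (t * d) r m ⟩
          t * d + (r + m) <⟨ +-monoʳ-< (t * d) (+-mono-<-≤ r<d (≤-trans (m≤m+n m (b ^ j)) m+g≤d)) ⟩
          t * d + (d + d) ≡⟨ +-assoc (t * d) d d ⟨
          t * d + d + d   ≡⟨ cong (_+ d) (+-comm (t * d) d) ⟩
          suc t * d + d   ∎))

  noZeroDigitAt-subinterval : ∀ x m u → b ^ j ≤ u → 3 * u ≤ m → m + b ^ j ≤ b ^ suc j →
    ∃[ y ] ([ y ,+ u ⟩ ⊆ [ x ,+ m ⟩ × [ y ,+ u ⟩ ⊆ NoZeroDigitAt b j)
  noZeroDigitAt-subinterval x m u g≤u 3u≤m m+g≤d with zeroDigitAt-in-one-block x m m+g≤d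
  ... | p , I⊆block∪good with avoid-block x u (b ^ j) p
  ... | y , J⊆ , J∌block = y , J⊆I ,
    λ n∈J → [ (λ in-block → contradiction in-block (J∌block n∈J)) , id ]
              (I⊆block∪good (J⊆I n∈J))
    where
    open ≤-Reasoning
    J⊆I : [ y ,+ u ⟩ ⊆ [ x ,+ m ⟩
    J⊆I = interval-mono (begin
      u + b ^ j + u ≤⟨ +-monoˡ-≤ u (+-monoʳ-≤ u g≤u) ⟩
      u + u + u     ≡⟨ +-assoc u u u ⟩
      u + (u + u)   ≡⟨ cong (λ v → u + (u + v)) (+-identityʳ u) ⟨
      3 * u         ≤⟨ 3u≤m ⟩
      m             ∎) ∘ J⊆

module _ (k : ℕ) where

  K : ℕ
  K = 3 ^ k

  M : ℕ
  M = suc (K * K)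

  private instance
    K≢0 = m^n≢0 3 k

  K<M : K < M
  K<M = s≤s (m≤m*n K K)

  1<M : 1 < M
  1<M = ≤-<-trans (m^n>0 3 k) K<M

  AtScale : ℕ → ℕ → Pred ℕ 0ℓ
  AtScale b σ j = b ^ j ≤ σ × σ < K * b ^ j

  atScale? : ∀ b σ j → Dec (AtScale b σ j)
  atScale? b σ j = b ^ j ≤? σ ×-dec σ <? K * b ^ j

  atScale-search : ∀ b → 1 < b → ∀ σ → Dec (∃[ j ] AtScale b σ j)
  atScale-search b 1<b σ = map′ (λ (j , _ , at) → j , at)
    (λ (j , at@(b^j≤σ , _)) → j , s≤s (<⇒≤ (<-≤-trans (n<m^n j 1<b) b^j≤σ)) , at)
    (anyUpTo? (atScale? b σ) (suc σ))

  ¬atScale-higher : ∀ {b σ} .{{_ : NonZero b}} → K ≤ b →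
    ∀ {j j′} → j < j′ → AtScale b σ j → ¬ AtScale b σ j′
  ¬atScale-higher {b} {σ} K≤b {j} {j′} j<j′ (_ , σ<K*b^j) (b^j′≤σ , _) =
    <⇒≱ σ<K*b^j (begin
      K * b ^ j ≤⟨ *-monoˡ-≤ (b ^ j) K≤b ⟩
      b ^ suc j ≤⟨ ^-monoʳ-≤ b j<j′ ⟩
      b ^ j′    ≤⟨ b^j′≤σ ⟩
      σ         ∎)
    where open ≤-Reasoning

  atScale-unique : ∀ {b σ} .{{_ : NonZero b}} → K ≤ b →
    ∀ {j j′} → AtScale b σ j → AtScale b σ j′ → j ≡ j′
  atScale-unique K≤b {j} {j′} at at′ with <-cmp j j′
  ... | tri< j<j′ _ _ = contradiction at′ (¬atScale-higher K≤b j<j′ at)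
  ... | tri≈ _ j≡j′ _ = j≡j′
  ... | tri> _ _ j′<j = contradiction at (¬atScale-higher K≤b j′<j at′)

  fits-period : ∀ {b σ j m} → M ≤ b → AtScale b σ j → m ≤ K * σ → m + b ^ j ≤ b ^ suc j
  fits-period {b} {σ} {j} {m} M≤b (_ , σ<K*g) m≤Kσ = begin
    m + g           ≤⟨ +-monoˡ-≤ g (≤-trans m≤Kσ (*-monoʳ-≤ K (<⇒≤ σ<K*g))) ⟩
    K * (K * g) + g ≡⟨ +-comm (K * (K * g)) g ⟩
    g + K * (K * g) ≡⟨ cong (g +_) (*-assoc K K g) ⟨
    M * g           ≤⟨ *-monoˡ-≤ g M≤b ⟩
    b * g           ∎
    where
    g = b ^ j
    open ≤-Reasoning

  clear-base : ∀ b → M ≤ b → ∀ σ u m x → σ ≤ u → 3 * u ≤ m → m ≤ K * σ →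
    ∃[ y ] ([ y ,+ u ⟩ ⊆ [ x ,+ m ⟩ ×
            (∀ j → AtScale b σ j → [ y ,+ u ⟩ ⊆ NoZeroDigitAt b j))
  clear-base b@(suc _) M≤b σ u m x σ≤u 3u≤m m≤Kσ with atScale-search b (<-≤-trans 1<M M≤b) σ
  ... | no ∄j = x , interval-mono (≤-trans (m≤n*m u 3) 3u≤m) , λ j at → contradiction (j , at) ∄j
  ... | yes (j₀ , at₀@(g≤σ , _))
      with noZeroDigitAt-subinterval b j₀ x m u (≤-trans g≤σ σ≤u) 3u≤m
             (fits-period {j = j₀} M≤b at₀ m≤Kσ)
  ...   | y , J⊆I , good = y , J⊆I , λ j at →
    subst (λ i → [ y ,+ u ⟩ ⊆ NoZeroDigitAt b i)
          (atScale-unique (<⇒≤ (<-≤-trans K<M M≤b)) {j₀} {j} at₀ at) good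

  clear-bases : ∀ s (c : Fin s → ℕ) → (∀ i → M ≤ c i) → 3 ^ s ≤ K → ∀ σ x →
    ∃[ y ] ([ y ,+ σ ⟩ ⊆ [ x ,+ 3 ^ s * σ ⟩ ×
            (∀ i j → AtScale (c i) σ j → [ y ,+ σ ⟩ ⊆ NoZeroDigitAt (c i) j))
  clear-bases zero c _ _ σ x = x , interval-mono (≤-reflexive (sym (*-identityˡ σ))) , λ ()
  clear-bases (suc s) c M≤c 3^[1+s]≤K σ x
    with clear-base (c zero) (M≤c zero) σ (3 ^ s * σ) (3 ^ suc s * σ) x
           (m≤n*m σ (3 ^ s) {{m^n≢0 3 s}}) (≤-reflexive (sym (*-assoc 3 (3 ^ s) σ)))
           (*-monoˡ-≤ σ 3^[1+s]≤K)
  ... | y₁ , J₁⊆I , good₁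
      with clear-bases s (c ∘ suc) (M≤c ∘ suc) (≤-trans (m≤n*m (3 ^ s) 3) 3^[1+s]≤K) σ y₁
  ...   | y₂ , J₂⊆J₁ , good₂ = y₂ , J₁⊆I ∘ J₂⊆J₁ ,
    λ { zero j at → good₁ j at ∘ J₂⊆J₁ ; (suc i) → good₂ i }

  module _ (1≤k : 1 ≤ k) (b : Fin k → ℕ) (M≤b : ∀ i → M ≤ b i) where

    private instance
      b≢0 : ∀ {i} → NonZero (b i)
      b≢0 {i} = >-nonZero (<-≤-trans z<s (M≤b i))

    2≤K : 2 ≤ K
    2≤K = ≤-trans (s≤s (s≤s z≤n)) (^-monoʳ-≤ 3 1≤k)

    -- K ^ t < K * b i ^ j  is  b i ^ j > K ^ (t - 1), stated without subtraction.
    Cleared : ℕ → ℕ → Set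
    Cleared t x = ∀ i j → K ^ t < K * b i ^ j → [ x ,+ K ^ t ⟩ ⊆ NoZeroDigitAt (b i) j

    cleared-initial : ∀ t → Cleared t (K ^ t)
    cleared-initial t i j K^t<K*g {n} (_ , n<K^t+K^t) =
      noZeroDigitAt-leading (b i) j n (begin-strict
        n             <⟨ n<K^t+K^t ⟩
        K ^ t + K ^ t <⟨ +-mono-< K^t<K*g K^t<K*g ⟩
        K * g + K * g ≡⟨ *-distribʳ-+ g K K ⟨
        (K + K) * g   ≤⟨ *-monoˡ-≤ g K+K≤b ⟩
        b i * g       ∎)
      where
      open ≤-Reasoning
      g = b i ^ j
      K+K≤b : K + K ≤ b i
      K+K≤b = begin
        K + K ≡⟨ cong (K +_) (+-identityʳ K) ⟨
        2 * K ≤⟨ *-monoˡ-≤ K 2≤K ⟩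
        K * K <⟨ n<1+n (K * K) ⟩
        M     ≤⟨ M≤b i ⟩
        b i   ∎

    clear-next-scale : ∀ t x → Cleared (suc t) x →
      ∃[ y ] ([ y ,+ K ^ t ⟩ ⊆ [ x ,+ K ^ suc t ⟩ × Cleared t y)
    clear-next-scale t x cleared with clear-bases k b M≤b ≤-refl (K ^ t) x
    ... | y , J⊆I , good = y , J⊆I , cleared′
      where
      cleared′ : Cleared t y
      cleared′ i j K^t<K*g with b i ^ j ≤? K ^ t
      ... | yes g≤K^t = good i j (g≤K^t , K^t<K*g)
      ... | no  g≰K^t = cleared i j (*-monoʳ-< K (≰⇒> g≰K^t)) ∘ J⊆I

    zero-free-in-cleared : ∀ t x → Cleared t x →
      ∃[ n ] (n ∈ [ x ,+ K ^ t ⟩ × ∀ i → NoZeroDigit (b i) n)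
    zero-free-in-cleared zero x cleared =
      x , x∈I , λ i j → cleared i j (<-≤-trans 2≤K (m≤m*n K (b i ^ j) {{m^n≢0 (b i) j}})) x∈I
      where
      x∈I : x ∈ [ x ,+ 1 ⟩
      x∈I = ≤-refl , m<m+n x z<s
    zero-free-in-cleared (suc t) x cleared with clear-next-scale t x cleared
    ... | y , J⊆I , cleared′ with zero-free-in-cleared t y cleared′
    ...   | n , n∈J , zero-free = n , J⊆I n∈J , zero-free

    zero-free-beyond : ∀ N → ∃[ n ] (N < n × ∀ i → NoZeroDigit (b i) n)
    zero-free-beyond N with zero-free-in-cleared N (K ^ N) (cleared-initial N)
    ... | n , (K^N≤n , _) , zero-free = n , <-≤-trans (n<m^n N 2≤K) K^N≤n , zero-free

theorem2p7 : (k : ℕ) → 2 ≤ k →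
    ∃[ M ] (1 ≤ M ×
      ((b : Fin k → ℕ) → MultIndep k b → ((i : Fin k) → M ≤ b i) →
        (N : ℕ) → ∃[ n ] (N < n × ((i : Fin k) → NoZeroDigit (b i) n))))
theorem2p7 k 2≤k = M k , s≤s z≤n , λ b _ M≤b → zero-free-beyond k (<⇒≤ 2≤k) b M≤b
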